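{- Let $G_1,\dots,G_n$ be graphs with roots $R_{G_1},\dots,R_{G_n}$, and let $G_1$ be connected. Suppose that for every $i\in\{1,\dots,n-1\}$ the distance $d(R_{G_1}\circ\cdots\circ R_{G_i},\,Res(G_1\circ\cdots\circ G_i,\,R_{G_1}\circ\cdots\circ R_{G_i}))$ in $G_1\circ\cdots\circ G_i$ is at least $3$. Then \[Res(G_1\circ G_2\circ\cdots\circ G_n,\;R_{G_1}\circ R_{G_2}\circ\cdots\circ R_{G_n})\cong Res(G_1,R_{G_1})\circ G_2\circ\cdots\circ G_n.\]
   Context: A root of a graph $G$ is an induced subgraph $R_G=\langle V_0\rangle$ on a nonempty vertex set $V_0$; with $V_i$ the set of vertices at distance exactly $i$ from $V_0$ and $r$ the largest $i$ with $V_i\ne\emptyset$, the distance-residual graph is $Res(G,R_G)=\langle V_r\rangle$, and $d(R_G,Res(G,R_G))=r$. $\circ$ is the (associative) lexicographic product: $V(G\circ H)=V(G)\times V(H)$ with $(u,x)\sim(v,y)$ iff $uv\in E(G)$, or ($u=v$ and $xy\in E(H)$). Products of roots are the induced subgraphs on the products of their vertex sets. -}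

module Defs where

open import Level using (Level)
open import Data.Nat using (ℕ; zero; suc; _≤_; _<_)
open import Data.Product using (Σ; ∃; _×_; _,_; proj₁; proj₂)
open import Data.Sum using (_⊎_; inj₁; inj₂)
open import Data.List using (List; []; _∷_; foldl; take; length)
open import Data.List.Membership.Propositional using (_∈_)
open import Data.Empty using (⊥)
open import Relation.Nullary using (¬_)
open import Relation.Binary.PropositionalEquality using (_≡_; refl; sym)
open import Data.Refinement using (Refinement; value)
open import Function.Bundles using (_↔_; _⇔_; Inverse)

record Graph : Set₁ where
  field
    V      : Set
    _~_    : V → V → Set
    ~-sym  : ∀ {u v} → u ~ v → v ~ u
    ~-irr  : ∀ {v} → ¬ (v ~ v)
open Graph public

Finite : Graph → Set
Finite G = Σ (List (V G)) λ xs → ∀ v → v ∈ xs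

data Walk (G : Graph) : ℕ → V G → V G → Set where
  here : ∀ {u} → Walk G zero u u
  step : ∀ {k u w v} → _~_ G u w → Walk G k w v → Walk G (suc k) u v

Connected : Graph → Set
Connected G = ∀ u v → ∃ λ k → Walk G k u v

-- Induced subgraph on a vertex predicate (proofs irrelevant, so each
-- vertex occurs at most once).
Induced : (G : Graph) → (V G → Set) → Graph
Induced G P = record
  { V = Refinement (V G) P
  ; _~_ = λ u v → _~_ G (value u) (value v)
  ; ~-sym = ~-sym G
  ; ~-irr = ~-irr G
  }

-- A root: a nonempty vertex set V₀ (the root graph is the subgraph induced on it).
record Root (G : Graph) : Set₁ where
  field
    mem      : V G → Set
    nonempty : ∃ mem
open Root public

-- v is at distance exactly i from the vertex set V₀ (v ∈ V_i)
DistEq : (G : Graph) → Root G → V G → ℕ → Set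
DistEq G R v i =
  (∃ λ u → mem R u × Walk G i u v) ×
  (∀ j u → mem R u → Walk G j u v → i ≤ j)

-- r is the largest i with V_i nonempty;  r = d(R_G, Res(G,R_G))
IsResDist : (G : Graph) → Root G → ℕ → Set
IsResDist G R r = (∃ λ v → DistEq G R v r) × (∀ j v → DistEq G R v j → j ≤ r)

-- Res(G,R_G) = ⟨V_r⟩ where r is the residual distance
Res : (G : Graph) → Root G → ℕ → Graph
Res G R r = Induced G (λ v → DistEq G R v r)

_∘ₗ_ : Graph → Graph → Graph
G ∘ₗ H = record
  { V = V G × V H
  ; _~_ = λ p q → (_~_ G (proj₁ p) (proj₁ q)) ⊎
                  ((proj₁ p ≡ proj₁ q) × _~_ H (proj₂ p) (proj₂ q))
  ; ~-sym = λ { (inj₁ a) → inj₁ (~-sym G a)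
              ; (inj₂ (e , b)) → inj₂ (sym e , ~-sym H b) }
  ; ~-irr = λ { (inj₁ a) → ~-irr G a ; (inj₂ (_ , b)) → ~-irr H b }
  }

_∘ᵣ_ : ∀ {G H} → Root G → Root H → Root (G ∘ₗ H)
R ∘ᵣ S = record
  { mem = λ p → mem R (proj₁ p) × mem S (proj₂ p)
  ; nonempty = (proj₁ (nonempty R) , proj₁ (nonempty S))
             , (proj₂ (nonempty R) , proj₂ (nonempty S)) }

RGraph : Set₁
RGraph = Σ Graph Root

_∘RG_ : RGraph → RGraph → RGraph
(G , R) ∘RG (H , S) = (G ∘ₗ H) , (R ∘ᵣ S)

prodR : RGraph → List RGraph → RGraph
prodR = foldl _∘RG_

prodG : Graph → List RGraph → Graph
prodG = foldl (λ A B → A ∘ₗ proj₁ B)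

record _≅_ (G H : Graph) : Set where
  field
    bij  : V G ↔ V H
    pres : ∀ u v → _~_ G u v ⇔ _~_ H (Inverse.to bij u) (Inverse.to bij v)

{-# OPTIONS --safe #-}
-- When A has no isolated vertices, every vertex (v , y) of A ∘ H lies within distance 2 of the
-- root R_A ∘ S (step to a neighbour of v and back), while a walk in A ∘ H from the root projects
-- to a walk in A that is no longer.  Hence a vertex (v , y) at distance t ≥ 3 from R_A ∘ S is
-- exactly a vertex v at distance t from R_A, paired with an arbitrary y.  So once the residual
-- distance of A is at least 3, taking a product with H preserves it and turns the residual graph
-- into Res(A, R_A) ∘ H.  A connected G₁ with residual distance ≥ 3 has no isolated vertices, and
-- products with further factors keep that property, so the step can be iterated.
module Submission where

open import Defs
open import Data.Nat using (zero; suc; z≤n; s≤s; _≤_; _<_; _≤?_)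
open import Data.Nat.Properties using (≤-trans; ≤-antisym; m≤n⇒m≤1+n; <⇒≤; ≤⇒≯; ≰⇒>)
open import Data.Product using (∃; _×_; _,_; proj₁; proj₂)
open import Data.Sum using (inj₁; inj₂)
open import Data.List using (List; []; _∷_; take; length)
open import Data.List.Relation.Unary.All using (All)
open import Data.Empty using (⊥-elim)
open import Relation.Nullary using (yes; no)
open import Relation.Binary.PropositionalEquality using (_≡_; _≢_; refl; sym; trans; cong; subst)
open import Data.Refinement using (_,_; value; value-injective)
import Data.Irrelevant as Irrelevant
open import Function.Bundles using (Equivalence; Inverse; Injection; mk↔ₛ′; mk⇔)
open import Function.Properties.Inverse using (↔-refl; ↔-trans; ↔⇒↣)
import Function.Properties.Equivalence as ⇔

NoIsolatedVertices : Graph → Set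
NoIsolatedVertices G = ∀ v → ∃ λ w → _~_ G v w

walk-zero⇒≡ : ∀ {G u v} → Walk G zero u v → u ≡ v
walk-zero⇒≡ here = refl

connected⇒noIsolatedVertices : ∀ {G u z} → Connected G → u ≢ z → NoIsolatedVertices G
connected⇒noIsolatedVertices {u = u} {z} conn u≢z v with conn v u | conn v z
... | suc _ , step e _ | _                = _ , e
... | zero , _         | suc _ , step e _ = _ , e
... | zero , v⇝u       | zero , v⇝z       =
  ⊥-elim (u≢z (trans (sym (walk-zero⇒≡ v⇝u)) (walk-zero⇒≡ v⇝z)))

distEq-root-≢ : ∀ {G R u v t} → 1 ≤ t → mem R u → DistEq G R v t → u ≢ v
distEq-root-≢ 1≤t u∈R (_ , minimal) refl = ≤⇒≯ (minimal 0 _ u∈R here) 1≤t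

isResDist-unique : ∀ {G R r r′} → IsResDist G R r → IsResDist G R r′ → r ≡ r′
isResDist-unique ((v , d) , maximal) ((v′ , d′) , maximal′) =
  ≤-antisym (maximal′ _ v d) (maximal _ v′ d′)

≅-refl : ∀ {G} → G ≅ G
≅-refl = record { bij = ↔-refl ; pres = λ _ _ → ⇔.refl }

≅-trans : ∀ {G H K} → G ≅ H → H ≅ K → G ≅ K
≅-trans i j = record
  { bij  = ↔-trans (_≅_.bij i) (_≅_.bij j)
  ; pres = λ u v → ⇔.trans (_≅_.pres i u v) (_≅_.pres j _ _)
  }

∘ₗ-congʳ : ∀ {G G′} H → G ≅ G′ → (G ∘ₗ H) ≅ (G′ ∘ₗ H)
∘ₗ-congʳ {G} {G′} H i = record
  { bij  = mk↔ₛ′ (λ (a , y) → to a , y) (λ (a , y) → from a , y)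
                 (λ (a , y) → cong (_, y) (strictlyInverseˡ a))
                 (λ (a , y) → cong (_, y) (strictlyInverseʳ a))
  ; pres = λ u v → mk⇔ to-adj from-adj
  }
  where
  open Inverse (_≅_.bij i)
  to-adj : ∀ {u v} → _~_ (G ∘ₗ H) u v → _~_ (G′ ∘ₗ H) (to (proj₁ u) , proj₂ u) (to (proj₁ v) , proj₂ v)
  to-adj (inj₁ e)        = inj₁ (Equivalence.to (_≅_.pres i _ _) e)
  to-adj (inj₂ (eq , e)) = inj₂ (cong to eq , e)
  from-adj : ∀ {u v} → _~_ (G′ ∘ₗ H) (to (proj₁ u) , proj₂ u) (to (proj₁ v) , proj₂ v) → _~_ (G ∘ₗ H) u v
  from-adj (inj₁ e)        = inj₁ (Equivalence.from (_≅_.pres i _ _) e)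
  from-adj (inj₂ (eq , e)) = inj₂ (Injection.injective (↔⇒↣ (_≅_.bij i)) eq , e)

prodG-cong : ∀ {G G′} → G ≅ G′ → ∀ rest → prodG G rest ≅ prodG G′ rest
prodG-cong i []               = i
prodG-cong i ((H , _) ∷ rest) = prodG-cong (∘ₗ-congʳ H i) rest

module _ (A H : Graph) where

  lift-walk : ∀ {k u v} → Walk A k u v → ∀ y → Walk (A ∘ₗ H) k (u , y) (v , y)
  lift-walk here       y = here
  lift-walk (step e w) y = step (inj₁ e) (lift-walk w y)

  lift-walk⁺ : ∀ {k u v} → Walk A (suc k) u v → ∀ x y → Walk (A ∘ₗ H) (suc k) (u , x) (v , y)
  lift-walk⁺ (step e w) x y = step (inj₁ e) (lift-walk w y)

  project-walk : ∀ {j p q} → Walk (A ∘ₗ H) j p q → ∃ λ j′ → j′ ≤ j × Walk A j′ (proj₁ p) (proj₁ q)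
  project-walk here = 0 , z≤n , here
  project-walk (step (inj₁ e) w) with project-walk w
  ... | j′ , j′≤j , w′ = suc j′ , s≤s j′≤j , step e w′
  project-walk (step (inj₂ (refl , _)) w) with project-walk w
  ... | j′ , j′≤j , w′ = j′ , m≤n⇒m≤1+n j′≤j , w′

  detour : NoIsolatedVertices A → ∀ v x y → Walk (A ∘ₗ H) 2 (v , x) (v , y)
  detour noIsolated v x y with noIsolated v
  ... | w , e = step {w = w , x} (inj₁ e) (step (inj₁ (~-sym A e)) here)

  ∘ₗ-noIsolatedVertices : NoIsolatedVertices A → NoIsolatedVertices (A ∘ₗ H)
  ∘ₗ-noIsolatedVertices noIsolated (v , y) = (proj₁ (noIsolated v) , y) , inj₁ (proj₂ (noIsolated v))

module _ (A H : Graph) (R : Root A) (S : Root H) where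

  private
    x₀ = proj₁ (nonempty S)
    x₀∈S = proj₂ (nonempty S)

  distEq⇒distEq-∘ₗ : ∀ {t v} → DistEq A R v (suc t) → ∀ y → DistEq (A ∘ₗ H) (R ∘ᵣ S) (v , y) (suc t)
  distEq⇒distEq-∘ₗ ((u , u∈R , w) , minimal) y =
    ((u , x₀) , (u∈R , x₀∈S) , lift-walk⁺ A H w x₀ y) ,
    λ j p (p₁∈R , _) w′ → let (j′ , j′≤j , w″) = project-walk A H w′ in
      ≤-trans (minimal j′ (proj₁ p) p₁∈R w″) j′≤j

  module _ (noIsolated : NoIsolatedVertices A) where

    -- A walk of length 0 would put v in the root, and then the detour gives t ≤ 2.
    distEq-∘ₗ-minimal : ∀ {t v y} → 3 ≤ t → DistEq (A ∘ₗ H) (R ∘ᵣ S) (v , y) t →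
                        ∀ m u → mem R u → Walk A m u v → t ≤ m
    distEq-∘ₗ-minimal 3≤t (_ , minimal) zero u u∈R w =
      ⊥-elim (≤⇒≯ (minimal 2 _ (subst (mem R) (walk-zero⇒≡ w) u∈R , x₀∈S) (detour A H noIsolated _ x₀ _)) 3≤t)
    distEq-∘ₗ-minimal 3≤t (_ , minimal) (suc m) u u∈R w =
      minimal (suc m) (u , x₀) (u∈R , x₀∈S) (lift-walk⁺ A H w x₀ _)

    distEq-∘ₗ⇒distEq : ∀ {t v y} → 3 ≤ t → DistEq (A ∘ₗ H) (R ∘ᵣ S) (v , y) t → DistEq A R v t
    distEq-∘ₗ⇒distEq 3≤t d@((p , (p₁∈R , _) , w) , _) with project-walk A H w
    ... | j′ , j′≤t , w′ =
      (proj₁ p , p₁∈R , subst (λ k → Walk A k _ _) (≤-antisym j′≤t (minimal j′ _ p₁∈R w′)) w′) ,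
      minimal
      where minimal = distEq-∘ₗ-minimal 3≤t d

    isResDist-∘ₗ : ∀ {s} → 3 ≤ s → IsResDist A R s → IsResDist (A ∘ₗ H) (R ∘ᵣ S) s
    isResDist-∘ₗ {suc s} 3≤s ((v , d) , maximal) = ((v , x₀) , distEq⇒distEq-∘ₗ d x₀) , maximal′
      where
      maximal′ : ∀ j p → DistEq (A ∘ₗ H) (R ∘ᵣ S) p j → j ≤ suc s
      maximal′ j p d′ with j ≤? 2
      ... | yes j≤2 = ≤-trans j≤2 (<⇒≤ 3≤s)
      ... | no j≰2  = maximal j (proj₁ p) (distEq-∘ₗ⇒distEq (≰⇒> j≰2) d′)

    Res-∘ₗ : ∀ {s} → 3 ≤ s → Res (A ∘ₗ H) (R ∘ᵣ S) s ≅ (Res A R s ∘ₗ H)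
    Res-∘ₗ {suc s} 3≤s = record
      { bij  = mk↔ₛ′ to from (λ _ → refl) (λ _ → refl)
      ; pres = λ p q → mk⇔ (to-adj {p} {q}) (from-adj {p} {q})
      }
      where
      to : V (Res (A ∘ₗ H) (R ∘ᵣ S) (suc s)) → V (Res A R (suc s) ∘ₗ H)
      to ((v , y) , d) = (v , Irrelevant.map (distEq-∘ₗ⇒distEq 3≤s) d) , y
      from : V (Res A R (suc s) ∘ₗ H) → V (Res (A ∘ₗ H) (R ∘ᵣ S) (suc s))
      from ((v , d) , y) = (v , y) , Irrelevant.map (λ d → distEq⇒distEq-∘ₗ d y) d
      to-adj : ∀ {p q} → _~_ (Res (A ∘ₗ H) (R ∘ᵣ S) (suc s)) p q → _~_ (Res A R (suc s) ∘ₗ H) (to p) (to q)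
      to-adj (inj₁ e)        = inj₁ e
      to-adj (inj₂ (eq , e)) = inj₂ (value-injective eq , e)
      from-adj : ∀ {p q} → _~_ (Res A R (suc s) ∘ₗ H) (to p) (to q) → _~_ (Res (A ∘ₗ H) (R ∘ᵣ S) (suc s)) p q
      from-adj (inj₁ e)        = inj₁ e
      from-adj (inj₂ (eq , e)) = inj₂ (cong value eq , e)

module _ {s} (3≤s : 3 ≤ s) where

  isResDist-prodR : ∀ A R → NoIsolatedVertices A → IsResDist A R s →
                    ∀ rest → IsResDist (proj₁ (prodR (A , R) rest)) (proj₂ (prodR (A , R) rest)) s
  isResDist-prodR A R noIsolated res []               = res
  isResDist-prodR A R noIsolated res ((H , S) ∷ rest) =
    isResDist-prodR (A ∘ₗ H) (R ∘ᵣ S) (∘ₗ-noIsolatedVertices A H noIsolated)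
                    (isResDist-∘ₗ A H R S noIsolated 3≤s res) rest

  Res-prodR : ∀ A R → NoIsolatedVertices A → IsResDist A R s →
              ∀ rest → Res (proj₁ (prodR (A , R) rest)) (proj₂ (prodR (A , R) rest)) s ≅ prodG (Res A R s) rest
  Res-prodR A R noIsolated res []               = ≅-refl
  Res-prodR A R noIsolated res ((H , S) ∷ rest) =
    ≅-trans (Res-prodR (A ∘ₗ H) (R ∘ᵣ S) (∘ₗ-noIsolatedVertices A H noIsolated)
                       (isResDist-∘ₗ A H R S noIsolated 3≤s res) rest)
            (prodG-cong (Res-∘ₗ A H R S noIsolated 3≤s) rest)

corollary3 : (G₁ : Graph) (R₁ : Root G₁) (rest : List RGraph) →
    Finite G₁ → All (λ B → Finite (proj₁ B)) rest →
    Connected G₁ →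
    (∀ k → k < length rest → ∀ s →
      IsResDist (proj₁ (prodR (G₁ , R₁) (take k rest)))
                (proj₂ (prodR (G₁ , R₁) (take k rest))) s → 3 ≤ s) →
    ∀ r₁ r → IsResDist G₁ R₁ r₁ →
    IsResDist (proj₁ (prodR (G₁ , R₁) rest)) (proj₂ (prodR (G₁ , R₁) rest)) r →
    Res (proj₁ (prodR (G₁ , R₁) rest)) (proj₂ (prodR (G₁ , R₁) rest)) r
      ≅ prodG (Res G₁ R₁ r₁) rest
corollary3 G₁ R₁ [] _ _ _ _ r₁ r res₁ res =
  subst (λ t → Res G₁ R₁ r ≅ Res G₁ R₁ t) (isResDist-unique {R = R₁} res res₁) ≅-refl
corollary3 G₁ R₁ rest@(_ ∷ _) _ _ conn far r₁ r res₁ res =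
  subst (λ t → Res (proj₁ product) (proj₂ product) t ≅ prodG (Res G₁ R₁ r₁) rest)
        (isResDist-unique {R = proj₂ product} (isResDist-prodR 3≤r₁ G₁ R₁ noIsolated res₁ rest) res)
        (Res-prodR 3≤r₁ G₁ R₁ noIsolated res₁ rest)
  where
  product = prodR (G₁ , R₁) rest
  3≤r₁ : 3 ≤ r₁
  3≤r₁ = far 0 (s≤s z≤n) r₁ res₁
  noIsolated : NoIsolatedVertices G₁
  noIsolated = connected⇒noIsolatedVertices conn
    (distEq-root-≢ {R = R₁} (≤-trans (s≤s z≤n) 3≤r₁) (proj₂ (nonempty R₁)) (proj₂ (proj₁ res₁)))
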